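{- Let $x,y$ be positive integers with $y\geq 2$. If $\frac{x^2-x+1}{xy-1}$ is a positive integer, then $\frac{x^2-x+1}{xy-1}=1$. -}

module Defs where

{-# OPTIONS --safe #-}
module Submission where

-- Clearing the truncated subtractions gives x² + k + 1 = x(1 + ky), so x divides
-- k + 1.  Writing k + 1 = mx and cancelling x leaves x + m = 1 + ky ≥ 2k + 1, whence
-- 2mx = 2(k + 1) ≤ x + m + 1 ≤ mx + 2 (as (m − 1)(x − 1) ≥ 0); so mx ≤ 2 and k ≤ 1.

open import Defs
open import Data.List using (_∷_; [])
open import Data.Nat using (ℕ; zero; suc; _+_; _*_; _∸_; _≤_; NonZero; >-nonZero; s≤s; z≤n; s≤s⁻¹)
open import Data.Nat.Divisibility using (_∣_; module _∣_; ∣m+n∣m⇒∣n; m∣m*n)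
open import Data.Nat.Properties
open import Data.Nat.Tactic.RingSolver using (solve)
open import Relation.Binary.PropositionalEquality
  using (_≡_; sym; trans; cong; cong₂; subst; module ≡-Reasoning)

m+n≤m*n+1 : ∀ m n .{{_ : NonZero m}} .{{_ : NonZero n}} → m + n ≤ m * n + 1
m+n≤m*n+1 m@(suc a) n@(suc b) = subst (m + n ≤_) expand (m≤m+n (m + n) (a * b))
  where
  expand : m + n + a * b ≡ m * n + 1
  expand = solve (a ∷ b ∷ [])

-- u and v stand for x * x ∸ x and x * y ∸ 1; adding x + k to u + 1 = kv clears them.
x²+k+1≡x[1+ky] : ∀ {x y k u v} → u + x ≡ x * x → v + 1 ≡ x * y → u + 1 ≡ k * v →
                 x * x + suc k ≡ x * (1 + k * y)
x²+k+1≡x[1+ky] {x} {y} {k} {u} {v} u+x≡x² v+1≡xy u+1≡kv = begin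
  x * x + suc k      ≡⟨ cong (_+ suc k) (sym u+x≡x²) ⟩
  u + x + suc k      ≡⟨ solve (u ∷ x ∷ k ∷ []) ⟩
  u + 1 + (x + k)    ≡⟨ cong (_+ (x + k)) u+1≡kv ⟩
  k * v + (x + k)    ≡⟨ solve (k ∷ v ∷ x ∷ []) ⟩
  x + k * (v + 1)    ≡⟨ cong (λ w → x + k * w) v+1≡xy ⟩
  x + k * (x * y)    ≡⟨ solve (x ∷ k ∷ y ∷ []) ⟩
  x * (1 + k * y)    ∎
  where open ≡-Reasoning

cofactor-equation : ∀ {x y k m} .{{_ : NonZero x}} →
                    x * x + suc k ≡ x * (1 + k * y) → suc k ≡ m * x → x + m ≡ 1 + k * y
cofactor-equation {x} {y} {k} {m} identity k+1≡mx = *-cancelˡ-≡ (x + m) (1 + k * y) x (begin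
  x * (x + m)      ≡⟨ *-distribˡ-+ x x m ⟩
  x * x + x * m    ≡⟨ cong (x * x +_) (trans (*-comm x m) (sym k+1≡mx)) ⟩
  x * x + suc k    ≡⟨ identity ⟩
  x * (1 + k * y)  ∎)
  where open ≡-Reasoning

cofactor-bound : ∀ {x y k} m .{{_ : NonZero x}} → 2 ≤ y → suc k ≡ m * x → x + m ≡ 1 + k * y → k ≤ 1
cofactor-bound zero _ ()
cofactor-bound {x} {y} {k} m@(suc _) 2≤y k+1≡mx x+m≡1+ky = s≤s⁻¹ (subst (_≤ 2) (sym k+1≡mx)
  (+-cancelˡ-≤ (m * x) (m * x) 2 (begin
    m * x + m * x    ≡⟨ cong₂ _+_ (sym k+1≡mx) (sym k+1≡mx) ⟩
    suc k + suc k    ≡⟨ solve (k ∷ []) ⟩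
    2 + k * 2        ≤⟨ +-monoʳ-≤ 2 (*-monoʳ-≤ k 2≤y) ⟩
    2 + k * y        ≡⟨ cong suc (sym x+m≡1+ky) ⟩
    1 + (x + m)      ≤⟨ +-monoʳ-≤ 1 (subst (_≤ m * x + 1) (+-comm m x) (m+n≤m*n+1 m x)) ⟩
    1 + (m * x + 1)  ≡⟨ +-suc (m * x) 1 ⟨
    m * x + 2        ∎)))
  where open ≤-Reasoning

lemma7 : (x y k : ℕ) → 1 ≤ x → 2 ≤ y → 1 ≤ k →
         x * x ∸ x + 1 ≡ k * (x * y ∸ 1) → k ≡ 1
lemma7 x y k 1≤x 2≤y 1≤k eq = ≤-antisym (cofactor-bound m 2≤y k+1≡mx x+m≡1+ky) 1≤k
  where
  instance
    x≢0 : NonZero x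
    x≢0 = >-nonZero 1≤x
    y≢0 : NonZero y
    y≢0 = >-nonZero (≤-trans (s≤s z≤n) 2≤y)
  identity : x * x + suc k ≡ x * (1 + k * y)
  identity = x²+k+1≡x[1+ky] (m∸n+n≡m (m≤m*n x x)) (m∸n+n≡m (≤-trans 1≤x (m≤m*n x y))) eq
  x∣k+1 : x ∣ suc k
  x∣k+1 = ∣m+n∣m⇒∣n (subst (x ∣_) (sym identity) (m∣m*n (1 + k * y))) (m∣m*n x)
  open _∣_ x∣k+1 renaming (quotient to m; equality to k+1≡mx)
  x+m≡1+ky : x + m ≡ 1 + k * y
  x+m≡1+ky = cofactor-equation identity k+1≡mx
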